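{- For $n\ge1$, the map $\pi\mapsto\pi^-$ is a bijection from $B_n^+$ to $B_n^-$, and for every $\pi\in B_n^+$: $\operatorname{cro}(\pi)=\operatorname{cro}(\pi^-)$, $\operatorname{neg}(\pi)=\operatorname{neg}(\pi^-)-1$, and $\operatorname{fwex}(\pi)=\operatorname{fwex}(\pi^-)+1$.
   Context: $B_n$ is the set of signed permutations $\pi=\pi_1\cdots\pi_n$ of $[n]$; $B_n^+=\{\pi:\pi_1>0\}$, $B_n^-=\{\pi:\pi_1<0\}$; $\pi^-=(-\pi_1)\pi_2\cdots\pi_n$. $\operatorname{wex}(\pi)=\#\{i:\pi_i\ge i\}$, $\operatorname{neg}(\pi)=\#\{i:\pi_i<0\}$, $\operatorname{fwex}=2\operatorname{wex}+\operatorname{neg}$. A crossing of $\pi$ is a pair $(i,j)$ with $i,j\in[n]$ such that $i<j\le\pi_i<\pi_j$, or $-i<j\le-\pi_i<\pi_j$, or $i>j>\pi_i>\pi_j$; $\operatorname{cro}(\pi)$ is their number. -}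

module Defs where

open import Data.Nat using (ℕ; zero; suc; _+_; _*_)
open import Data.Integer as ℤ using (ℤ; +_; -_)
open import Data.Bool using (Bool; true; false; not; if_then_else_)
open import Data.Fin using (Fin; zero; suc; toℕ)
open import Data.Fin.Permutation using (Permutation′; _⟨$⟩ʳ_)
open import Data.List using (List; length; filter; allFin; cartesianProduct)
open import Data.Product using (_×_; _,_)
open import Data.Sum using (_⊎_)
open import Relation.Unary using (Decidable)
open import Relation.Binary.PropositionalEquality using (_≡_)
open import Relation.Nullary.Decidable using (_×-dec_; _⊎-dec_)

-- Position i (0-based Fin index k, i = k+1) carries the value ±(σ(k)+1).
record SignedPerm (n : ℕ) : Set where
  constructor mkSP
  field
    perm : Permutation′ n
    negSign : Fin n → Bool

open SignedPerm public

val : ∀ {n} → SignedPerm n → Fin n → ℤ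
val π k = if negSign π k then - (+ suc (toℕ (perm π ⟨$⟩ʳ k))) else + suc (toℕ (perm π ⟨$⟩ʳ k))

pos : ∀ {n} → Fin n → ℤ
pos k = + suc (toℕ k)

IsPos : ∀ {m} → SignedPerm (suc m) → Set
IsPos π = ℤ.0ℤ ℤ.< val π zero

IsNeg : ∀ {m} → SignedPerm (suc m) → Set
IsNeg π = val π zero ℤ.< ℤ.0ℤ

flipFirst : ∀ {m} → (Fin (suc m) → Bool) → Fin (suc m) → Bool
flipFirst s zero = not (s zero)
flipFirst s (suc k) = s (suc k)

_⁻ : ∀ {m} → SignedPerm (suc m) → SignedPerm (suc m)
(mkSP σ s) ⁻ = mkSP σ (flipFirst s)

wex : ∀ {n} → SignedPerm n → ℕ
wex π = length (filter (λ k → pos k ℤ.≤? val π k) (allFin _))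

neg : ∀ {n} → SignedPerm n → ℕ
neg π = length (filter (λ k → val π k ℤ.<? ℤ.0ℤ) (allFin _))

fwex : ∀ {n} → SignedPerm n → ℕ
fwex π = 2 * wex π + neg π

IsCrossing : ∀ {n} → SignedPerm n → Fin n × Fin n → Set
IsCrossing π (k , l) =
  (i ℤ.< j × j ℤ.≤ a × a ℤ.< b)
  ⊎ ((- i ℤ.< j × j ℤ.≤ - a × - a ℤ.< b)
  ⊎ (j ℤ.< i × a ℤ.< j × b ℤ.< a))
  where
  i = pos k
  j = pos l
  a = val π k
  b = val π l

isCrossing? : ∀ {n} (π : SignedPerm n) → Decidable (IsCrossing π)
isCrossing? π (k , l) =
  (pos k ℤ.<? pos l ×-dec (pos l ℤ.≤? val π k ×-dec val π k ℤ.<? val π l))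
  ⊎-dec ((- pos k ℤ.<? pos l ×-dec (pos l ℤ.≤? - val π k ×-dec - val π k ℤ.<? val π l))
  ⊎-dec (pos l ℤ.<? pos k ×-dec (val π k ℤ.<? pos l ×-dec val π l ℤ.<? val π k)))

cro : ∀ {n} → SignedPerm n → ℕ
cro {n} π = length (filter (isCrossing? π) (cartesianProduct (allFin n) (allFin n)))

_≋_ : ∀ {n} → SignedPerm n → SignedPerm n → Set
π ≋ ρ = ∀ k → val π k ≡ val ρ k

-- Flipping the sign of π₁ > 0 only changes position 1, which passes from a weak
-- excedance (1 ≤ π₁) to a negative entry: wex drops by one, neg rises by one, so
-- fwex = 2 wex + neg drops by one. Only crossings involving position 1 could change,
-- and they do not: for j ≥ 2, (1, j) is a crossing of π and of π⁻ exactly when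
-- j ≤ |π₁| < π_j, and (i, 1) exactly when π_i < 0 and |π_i| < |π₁|.
module Submission where

open import Defs
open import Data.Nat using (ℕ; suc; _+_; _*_; s≤s; z≤n)
open import Data.Nat.Properties using (+-comm)
open import Data.Nat.Tactic.RingSolver using (solve-∀)
open import Data.Integer as ℤ using (ℤ; -_; 0ℤ; 1ℤ; +0; +[1+_]; -[1+_]; +<+; -<+; -<-; +≤+)
open import Data.Integer.Properties
  using (neg-involutive; neg-injective; neg-mono-<; <-irrefl; <-asym; <-trans; <⇒≱; i<j⇒suc[i]≤j)
open import Data.Fin using (zero; suc)
open import Data.List using (_∷_; length; filter; tabulate; allFin; cartesianProduct)
open import Data.List.Properties using (filter-accept; filter-reject)
open import Data.List.Relation.Unary.All using (All; []; _∷_; universal)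
open import Data.List.Relation.Unary.All.Properties using (tabulate⁺)
open import Data.Product using (_×_; Σ; _,_)
open import Data.Sum using (_⊎_; inj₁; inj₂)
open import Data.Empty using (⊥-elim)
open import Data.Bool using (true; false)
open import Function using (_∘_)
open import Function.Bundles using (_⇔_; mk⇔; Equivalence)
open import Function.Construct.Identity using (⇔-id)
open import Relation.Nullary using (¬_; Dec; yes; no)
open import Relation.Unary using (Pred; Decidable)
open import Relation.Binary.PropositionalEquality
  using (_≡_; _≢_; refl; sym; trans; cong; subst; module ≡-Reasoning)

filter-cong : ∀ {a p q} {A : Set a} {P : Pred A p} {Q : Pred A q} (P? : Decidable P) (Q? : Decidable Q) {xs} →
              All (λ x → P x ⇔ Q x) xs → filter P? xs ≡ filter Q? xs
filter-cong P? Q? [] = refl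
filter-cong P? Q? {x ∷ _} (P⇔Q ∷ P⇔Qs) with P? x
... | yes Px = trans (cong (x ∷_) (filter-cong P? Q? P⇔Qs)) (sym (filter-accept Q? (Equivalence.to P⇔Q Px)))
... | no ¬Px = trans (filter-cong P? Q? P⇔Qs) (sym (filter-reject Q? (¬Px ∘ Equivalence.from P⇔Q)))

⁻-head : ∀ {m} (π : SignedPerm (suc m)) → val (π ⁻) zero ≡ - val π zero
⁻-head π with negSign π zero
... | true = sym (neg-involutive _)
... | false = refl

⁻-involutive : ∀ {m} (π : SignedPerm (suc m)) → ((π ⁻) ⁻) ≋ π
⁻-involutive π zero = trans (⁻-head (π ⁻)) (trans (cong -_ (⁻-head π)) (neg-involutive _))
⁻-involutive π (suc k) = refl

⁻-injective : ∀ {m} (π ρ : SignedPerm (suc m)) → (π ⁻) ≋ (ρ ⁻) → π ≋ ρ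
⁻-injective π ρ π⁻≋ρ⁻ zero = neg-injective (trans (sym (⁻-head π)) (trans (π⁻≋ρ⁻ zero) (⁻-head ρ)))
⁻-injective π ρ π⁻≋ρ⁻ (suc k) = π⁻≋ρ⁻ (suc k)

⁻-isNeg : ∀ {m} (π : SignedPerm (suc m)) → IsPos π → IsNeg (π ⁻)
⁻-isNeg π π₁>0 = subst (ℤ._< 0ℤ) (sym (⁻-head π)) (neg-mono-< π₁>0)

⁻-isPos : ∀ {m} (π : SignedPerm (suc m)) → IsNeg π → IsPos (π ⁻)
⁻-isPos π π₁<0 = subst (0ℤ ℤ.<_) (sym (⁻-head π)) (neg-mono-< π₁<0)

val-≢0 : ∀ {n} (π : SignedPerm n) k → val π k ≢ 0ℤ
val-≢0 π k with negSign π k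
... | true = λ ()
... | false = λ ()

-- IsCrossing π (k , l) unfolds to Crossing (pos k) (pos l) (val π k) (val π l).
Crossing : ℤ → ℤ → ℤ → ℤ → Set
Crossing i j a b =
  (i ℤ.< j × j ℤ.≤ a × a ℤ.< b)
  ⊎ ((- i ℤ.< j × j ℤ.≤ - a × - a ℤ.< b)
  ⊎ (j ℤ.< i × a ℤ.< j × b ℤ.< a))

¬Crossing-1-1 : ∀ a → ¬ Crossing 1ℤ 1ℤ a a
¬Crossing-1-1 _ (inj₁ (1<1 , _)) = <-irrefl refl 1<1
¬Crossing-1-1 +0 (inj₂ (inj₁ (_ , +≤+ () , _)))
¬Crossing-1-1 +[1+ _ ] (inj₂ (inj₁ (_ , () , _)))
¬Crossing-1-1 -[1+ _ ] (inj₂ (inj₁ (_ , _ , ())))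
¬Crossing-1-1 _ (inj₂ (inj₂ (1<1 , _))) = <-irrefl refl 1<1

Crossing-first-row : ∀ {a a′ b} l → 0ℤ ℤ.< a → a′ ≡ - a →
                     Crossing 1ℤ +[1+ suc l ] a b ⇔ Crossing 1ℤ +[1+ suc l ] a′ b
Crossing-first-row {+0} _ (+<+ ()) _
Crossing-first-row {+[1+ n ]} {b = b} l _ refl = mk⇔ to from
  where
  to : Crossing 1ℤ +[1+ suc l ] +[1+ n ] b → Crossing 1ℤ +[1+ suc l ] -[1+ n ] b
  to (inj₁ (_ , j≤a , a<b)) = inj₂ (inj₁ (-<+ , j≤a , a<b))
  to (inj₂ (inj₁ (_ , () , _)))
  to (inj₂ (inj₂ (+<+ (s≤s ()) , _)))
  from : Crossing 1ℤ +[1+ suc l ] -[1+ n ] b → Crossing 1ℤ +[1+ suc l ] +[1+ n ] b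
  from (inj₁ (_ , () , _))
  from (inj₂ (inj₁ (_ , j≤a , a<b))) = inj₁ (+<+ (s≤s (s≤s z≤n)) , j≤a , a<b)
  from (inj₂ (inj₂ (+<+ (s≤s ()) , _)))

Crossing-first-column : ∀ {a a′ b} k → 0ℤ ℤ.< a → a′ ≡ - a → b ≢ 0ℤ →
                        Crossing +[1+ suc k ] 1ℤ b a ⇔ Crossing +[1+ suc k ] 1ℤ b a′
Crossing-first-column {+0} _ (+<+ ()) _ _
Crossing-first-column {+[1+ n ]} {b = b} k _ refl b≢0 = mk⇔ (to b) (from b b≢0)
  where
  to : ∀ b → Crossing +[1+ suc k ] 1ℤ b +[1+ n ] → Crossing +[1+ suc k ] 1ℤ b -[1+ n ]
  to _ (inj₁ (+<+ (s≤s ()) , _))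
  to +0 (inj₂ (inj₁ (_ , +≤+ () , _)))
  to +[1+ _ ] (inj₂ (inj₁ (_ , () , _)))
  to -[1+ _ ] (inj₂ (inj₁ (_ , _ , +<+ (s≤s q<n)))) = inj₂ (inj₂ (+<+ (s≤s (s≤s z≤n)) , -<+ , -<- q<n))
  to +0 (inj₂ (inj₂ (_ , _ , +<+ ())))
  to +[1+ _ ] (inj₂ (inj₂ (_ , +<+ (s≤s ()) , _)))
  to -[1+ _ ] (inj₂ (inj₂ (_ , _ , ())))
  from : ∀ b → b ≢ 0ℤ → Crossing +[1+ suc k ] 1ℤ b -[1+ n ] → Crossing +[1+ suc k ] 1ℤ b +[1+ n ]
  from _ _ (inj₁ (+<+ (s≤s ()) , _))
  from +0 _ (inj₂ (inj₁ (_ , +≤+ () , _)))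
  from +[1+ _ ] _ (inj₂ (inj₁ (_ , () , _)))
  from -[1+ _ ] _ (inj₂ (inj₁ (_ , _ , ())))
  from +0 b≢0 (inj₂ (inj₂ _)) = ⊥-elim (b≢0 refl)
  from +[1+ _ ] _ (inj₂ (inj₂ (_ , +<+ (s≤s ()) , _)))
  from -[1+ _ ] _ (inj₂ (inj₂ (_ , _ , -<- q<n))) = inj₂ (inj₁ (-<+ , +≤+ (s≤s z≤n) , +<+ (s≤s q<n)))

⁻-isCrossing⇔ : ∀ {m} (π : SignedPerm (suc m)) → IsPos π → ∀ p → IsCrossing π p ⇔ IsCrossing (π ⁻) p
⁻-isCrossing⇔ π _ (zero , zero) =
  mk⇔ (⊥-elim ∘ ¬Crossing-1-1 (val π zero)) (⊥-elim ∘ ¬Crossing-1-1 (val (π ⁻) zero))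
⁻-isCrossing⇔ π π₁>0 (zero , suc l) = Crossing-first-row _ π₁>0 (⁻-head π)
⁻-isCrossing⇔ π π₁>0 (suc k , zero) = Crossing-first-column _ π₁>0 (⁻-head π) (val-≢0 π (suc k))
⁻-isCrossing⇔ π _ (suc k , suc l) = ⇔-id _

cro-⁻ : ∀ {m} (π : SignedPerm (suc m)) → IsPos π → cro π ≡ cro (π ⁻)
cro-⁻ {m} π π₁>0 =
  cong length (filter-cong (isCrossing? π) (isCrossing? (π ⁻)) (universal (⁻-isCrossing⇔ π π₁>0) pairs))
  where pairs = cartesianProduct (allFin (suc m)) (allFin (suc m))

-- wex π and neg π are count ℤ._≤?_ π and count (λ _ a → a ℤ.<? 0ℤ) π on the nose.
count : ∀ {n} {Q : ℤ → ℤ → Set} → (∀ i a → Dec (Q i a)) → SignedPerm n → ℕ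
count Q? π = length (filter (λ k → Q? (pos k) (val π k)) (allFin _))

count-head-gain : ∀ {m} {Q : ℤ → ℤ → Set} (Q? : ∀ i a → Dec (Q i a)) (π ρ : SignedPerm (suc m)) →
                  (∀ k → val π (suc k) ≡ val ρ (suc k)) → ¬ Q 1ℤ (val π zero) → Q 1ℤ (val ρ zero) →
                  count Q? ρ ≡ suc (count Q? π)
count-head-gain {Q = Q} Q? π ρ same-tail ¬Qπ₁ Qρ₁ = begin
  count Q? ρ                                ≡⟨ cong length (filter-accept ρ? Qρ₁) ⟩
  suc (length (filter ρ? (tabulate suc)))   ≡⟨ cong (suc ∘ length) (filter-cong ρ? π? (tabulate⁺ tail⇔)) ⟩
  suc (length (filter π? (tabulate suc)))   ≡⟨ cong (suc ∘ length) (filter-reject π? ¬Qπ₁) ⟨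
  suc (count Q? π)                          ∎
  where
  open ≡-Reasoning
  π? = λ k → Q? (pos k) (val π k)
  ρ? = λ k → Q? (pos k) (val ρ k)
  tail⇔ : ∀ k → Q (pos (suc k)) (val ρ (suc k)) ⇔ Q (pos (suc k)) (val π (suc k))
  tail⇔ k = mk⇔ (subst (Q _) (sym (same-tail k))) (subst (Q _) (same-tail k))

lemma3p10 : (m : ℕ) →
    ((π : SignedPerm (suc m)) → IsPos π → IsNeg (π ⁻))
    × ((π ρ : SignedPerm (suc m)) → IsPos π → IsPos ρ → (π ⁻) ≋ (ρ ⁻) → π ≋ ρ)
    × ((σ : SignedPerm (suc m)) → IsNeg σ → Σ (SignedPerm (suc m)) (λ π → IsPos π × (π ⁻) ≋ σ))
    × ((π : SignedPerm (suc m)) → IsPos π →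
         (cro π ≡ cro (π ⁻)) × (neg π + 1 ≡ neg (π ⁻)) × (fwex π ≡ fwex (π ⁻) + 1))
lemma3p10 m =
  ⁻-isNeg , (λ π ρ _ _ → ⁻-injective π ρ) , (λ σ σ₁<0 → σ ⁻ , ⁻-isPos σ σ₁<0 , ⁻-involutive σ) , statistics
  where
  statistics : (π : SignedPerm (suc m)) → IsPos π →
               (cro π ≡ cro (π ⁻)) × (neg π + 1 ≡ neg (π ⁻)) × (fwex π ≡ fwex (π ⁻) + 1)
  statistics π π₁>0 = cro-⁻ π π₁>0 , trans (+-comm (neg π) 1) (sym neg-gain) , fwex-loss
    where
    open ≡-Reasoning
    π⁻₁<0 : IsNeg (π ⁻)
    π⁻₁<0 = ⁻-isNeg π π₁>0
    neg-gain : neg (π ⁻) ≡ suc (neg π)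
    neg-gain = count-head-gain (λ _ a → a ℤ.<? 0ℤ) π (π ⁻) (λ _ → refl) (<-asym π₁>0) π⁻₁<0
    wex-loss : wex π ≡ suc (wex (π ⁻))
    wex-loss = count-head-gain ℤ._≤?_ (π ⁻) π (λ _ → refl)
                 (<⇒≱ (<-trans π⁻₁<0 (+<+ (s≤s z≤n)))) (i<j⇒suc[i]≤j π₁>0)
    fwex-loss : fwex π ≡ fwex (π ⁻) + 1
    fwex-loss = begin
      2 * wex π + neg π                    ≡⟨ cong (λ w → 2 * w + neg π) wex-loss ⟩
      2 * suc (wex (π ⁻)) + neg π          ≡⟨ regroup (wex (π ⁻)) (neg π) ⟩
      2 * wex (π ⁻) + suc (neg π) + 1      ≡⟨ cong (λ g → 2 * wex (π ⁻) + g + 1) neg-gain ⟨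
      fwex (π ⁻) + 1                       ∎
      where
      regroup : ∀ w g → 2 * suc w + g ≡ 2 * w + suc g + 1
      regroup = solve-∀
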